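{- Let $a>1$ and $0<j<a$ be integers with $\gcd(j,a)=1$, and let $\mathcal{E}$ be a nontrivial Zeckendorf collection for positive integers. Then $j+a\mathbb{N}=\{j+an:n\in\mathbb{N}\}$ is not an $\mathcal{E}$-subset of $\mathbb{N}$.
   Context: $\mathbb{N}=\{1,2,\dots\}$. A coefficient function is a map $\epsilon:\mathbb{N}\to\{0,1,2,\dots\}$; $\sum\epsilon Q=\sum_k\epsilon_kQ_k$; $\beta^i$ has $\beta^i_i=1$ and $0$ elsewhere. For finite-support functions, $\mu<_a\mu'$ means at the largest index where they differ $\mu$ has the smaller value. A Zeckendorf collection for positive integers is a set $\mathcal{E}$ of finite-support coefficient functions containing $0$ and all $\beta^i$, ordered by $<_a$, with $\hat\beta^n$ the largest element below $\beta^n$, such that (1) each $\mu\in\mathcal{E}$ has finitely many elements below it, and (2) for $\mu\in\mathcal{E}$, if its immediate successor (smallest greater element) $\tilde\mu$ is not $\beta^1+\mu$, then there is $n\ge2$ with $\mu_k=\hat\beta^n_k$ for $k<n$ and $\tilde\mu=\beta^n+\sum_{k\ge n}\mu_k\beta^k$. It is nontrivial if $\mathcal{E}\ne\{0\}\cup\{\beta^n:n\ge1\}$. A subset $Y\subseteq\mathbb{N}$ is an $\mathcal{E}$-subset if there is a sequence $Q$ of positive integers such that the values $\sum\delta Q$, $\delta\in\mathcal{E}$, are pairwise distinct and $\{\sum\delta Q:\delta\in\mathcal{E},\delta\ne0\}=Y$. -}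

module Defs where

open import Data.Nat using (ℕ; zero; suc; _+_; _*_; _≤_; _<_; _≟_; _<ᵇ_)
open import Data.Nat.GCD public using (gcd)
open import Data.Bool using (if_then_else_)
open import Data.Product using (Σ; ∃; _×_; _,_)
open import Data.Sum using (_⊎_)
open import Data.List using (List)
open import Data.List.Membership.Propositional using (_∈_)
open import Relation.Nullary using (¬_; does)
open import Relation.Binary.PropositionalEquality using (_≡_; _≗_)
open import Function.Bundles using (_⇔_)

-- INDEXING CONVENTION: the paper indexes coefficient functions by
-- ℕ = {1,2,...}.  Here a coefficient function is  ℕ → ℕ  with Agda index
-- k standing for the paper's index k+1.  So paper β^1 is  β 0, paper
-- "n ≥ 2" is Agda "n ≥ 1", and paper "k < n" is Agda "k < n" after the shift.

Coeff : Set
Coeff = ℕ → ℕ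

Bound : Coeff → ℕ → Set
Bound μ N = ∀ k → N ≤ k → μ k ≡ 0

FinSupp : Coeff → Set
FinSupp μ = ∃ λ N → Bound μ N

zeroC : Coeff
zeroC _ = 0

β : ℕ → Coeff
β i k = if does (k ≟ i) then 1 else 0

_⊕_ : Coeff → Coeff → Coeff
(μ ⊕ ν) k = μ k + ν k

_<a_ : Coeff → Coeff → Set
μ <a μ' = ∃ λ n → μ n < μ' n × (∀ k → n < k → μ k ≡ μ' k)

_≤a_ : Coeff → Coeff → Set
μ ≤a μ' = μ <a μ' ⊎ μ ≗ μ'

jumpTo : ℕ → Coeff → Coeff
jumpTo n μ k = if k <ᵇ n then 0 else (β n k + μ k)

record Zeckendorf (E : Coeff → Set) : Set₁ where
  field
    ext       : ∀ μ ν → μ ≗ ν → E μ → E ν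
    finSupp   : ∀ μ → E μ → FinSupp μ
    hasZero   : E zeroC
    hasβ      : ∀ i → E (β i)
    finBelow  : ∀ μ → E μ → Σ (List Coeff) λ L →
                  ∀ ν → E ν → ν <a μ → ∃ λ ν' → ν' ∈ L × ν ≗ ν'
    succShape : ∀ μ μ~ → E μ → E μ~ →
                  μ <a μ~ → (∀ ν → E ν → μ <a ν → μ~ ≤a ν) →
                  ¬ (μ~ ≗ (β 0 ⊕ μ)) →
                  ∃ λ n → 1 ≤ n × ∃ λ βhat →
                    (E βhat × βhat <a β n × (∀ ν → E ν → ν <a β n → ν ≤a βhat)) ×
                    (∀ k → k < n → μ k ≡ βhat k) ×
                    (μ~ ≗ jumpTo n μ)

Nontrivial : (Coeff → Set) → Set
Nontrivial E = ∃ λ μ → E μ × ¬ (μ ≗ zeroC) × (∀ n → ¬ (μ ≗ β n))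

sumTo : ℕ → Coeff → (ℕ → ℕ) → ℕ
sumTo zero    δ Q = 0
sumTo (suc N) δ Q = sumTo N δ Q + δ N * Q N

SumIs : Coeff → (ℕ → ℕ) → ℕ → Set
SumIs δ Q s = ∃ λ N → Bound δ N × sumTo N δ Q ≡ s

-- Y (a predicate on ℕ, meant to be a subset of the positive integers) is an E-subset
IsESubset : (Coeff → Set) → (ℕ → Set) → Set
IsESubset E Y = Σ (ℕ → ℕ) λ Q →
  (∀ k → 1 ≤ Q k) ×
  (∀ δ δ' s → E δ → E δ' → SumIs δ Q s → SumIs δ' Q s → δ ≗ δ') ×
  (∀ y → Y y ⇔ (∃ λ δ → E δ × ¬ (δ ≗ zeroC) × SumIs δ Q y))

ArithProg : ℕ → ℕ → ℕ → Set
ArithProg j a y = ∃ λ n → 1 ≤ n × y ≡ j + a * n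

-- Each Q p is the value of β p, so lies in j + aℕ; the sum of two such values is 2j ≢ j (mod a),
-- so E contains no β p ⊕ β q.  On the other hand, in a nontrivial Zeckendorf collection take
-- the least element μ that is neither 0 nor some β n.  Its immediate predecessor is then 0 or
-- some β m, and the successor rule (2) forces μ to be β n or β n ⊕ β m, a contradiction.
module Submission where

open import Defs
open import Data.Nat using (ℕ; _<_)
open import Relation.Binary.PropositionalEquality using (_≡_)
open import Relation.Nullary using (¬_)

open import Data.Nat using (zero; suc; _+_; _*_; _≤_; _≟_; _<?_; z≤n; s≤s; NonZero; >-nonZero; _%_)
open import Data.Nat.Properties
open import Data.Nat.DivMod using ([m+kn]%n≡m%n; m*n%n≡0; m<n⇒m%n≡m)
open import Data.Nat.Tactic.RingSolver using (solve-∀)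
open import Data.Product using (∃; ∃₂; _×_; _,_)
open import Data.Sum using (_⊎_; inj₁; inj₂; [_,_])
open import Data.List using (List; []; _∷_)
open import Data.List.Relation.Unary.All as All using (All; []; _∷_)
open import Function using (_∘_; flip; id)
open import Function.Bundles using (Equivalence)
open import Relation.Binary.PropositionalEquality using (refl; sym; trans; cong; cong₂; subst; _≢_; _≗_; module ≡-Reasoning)
open import Relation.Binary using (tri<; tri≈; tri>)
open import Relation.Nullary using (Dec; yes; no; contradiction)
open import Relation.Nullary.Decidable using (dec-true; dec-false; ¬¬-excluded-middle)
open import Relation.Nullary.Negation using (¬¬-Monad)
open import Effect.Monad using (RawMonad)
open import Level using (0ℓ)

open RawMonad (¬¬-Monad {0ℓ})

β-diag : ∀ i → β i i ≡ 1
β-diag i rewrite dec-true (i ≟ i) refl = refl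

β-off : ∀ {i k} → k ≢ i → β i k ≡ 0
β-off {i} {k} k≢i rewrite dec-false (k ≟ i) k≢i = refl

β-< : ∀ {i k} → k < i → β i k ≡ 0
β-< = β-off ∘ <⇒≢

β-> : ∀ {i k} → i < k → β i k ≡ 0
β-> = β-off ∘ >⇒≢

β≢zeroC : ∀ i → ¬ β i ≗ zeroC
β≢zeroC i β≗0 = contradiction (trans (sym (β-diag i)) (β≗0 i)) λ ()

jumpTo-< : ∀ {n k} μ → k < n → jumpTo n μ k ≡ 0
jumpTo-< {n} {k} μ k<n rewrite dec-true (k <? n) k<n = refl

jumpTo-≥ : ∀ {n k} μ → n ≤ k → jumpTo n μ k ≡ β n k + μ k
jumpTo-≥ {n} {k} μ n≤k rewrite dec-false (k <? n) (≤⇒≯ n≤k) = refl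

jumpTo-vanishingFrom : ∀ {n μ} → (∀ k → n ≤ k → μ k ≡ 0) → jumpTo n μ ≗ β n
jumpTo-vanishingFrom {n} {μ} μ≡0 k with k <? n
... | yes k<n = trans (jumpTo-< μ k<n) (sym (β-< k<n))
... | no  k≮n = trans (jumpTo-≥ μ n≤k) (trans (cong (β n k +_) (μ≡0 k n≤k)) (+-identityʳ _))
  where n≤k = ≮⇒≥ k≮n

jumpTo-vanishingBelow : ∀ {n μ} → (∀ k → k < n → μ k ≡ 0) → jumpTo n μ ≗ β n ⊕ μ
jumpTo-vanishingBelow {n} {μ} μ≡0 k with k <? n
... | yes k<n = trans (jumpTo-< μ k<n) (sym (cong₂ _+_ (β-< k<n) (μ≡0 k k<n)))
... | no  k≮n = jumpTo-≥ μ (≮⇒≥ k≮n)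

Monomial : Coeff → Set
Monomial ν = ∃ λ n → ν ≗ β n

Binomial : Coeff → Set
Binomial ν = ∃₂ λ p q → ν ≗ β p ⊕ β q

IsTrivial : Coeff → Set
IsTrivial μ = μ ≗ zeroC ⊎ Monomial μ

IsTrivial-resp : ∀ {μ ν} → μ ≗ ν → IsTrivial ν → IsTrivial μ
IsTrivial-resp μ≗ν (inj₁ ν≗0)      = inj₁ λ k → trans (μ≗ν k) (ν≗0 k)
IsTrivial-resp μ≗ν (inj₂ (n , ν≗β)) = inj₂ (n , λ k → trans (μ≗ν k) (ν≗β k))

β0⊕-trivial : ∀ {μ ν} → IsTrivial μ → ν ≗ β 0 ⊕ μ → Monomial ν ⊎ Binomial ν
β0⊕-trivial (inj₁ μ≗0) ν≗ = inj₁ (0 , λ k → trans (ν≗ k) (trans (cong (β 0 k +_) (μ≗0 k)) (+-identityʳ _)))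
β0⊕-trivial (inj₂ (m , μ≗β)) ν≗ = inj₂ (0 , m , λ k → trans (ν≗ k) (cong (β 0 k +_) (μ≗β k)))

jumpTo-trivial : ∀ {n μ ν} → IsTrivial μ → ν ≗ jumpTo n μ → Monomial ν ⊎ Binomial ν
jumpTo-trivial {n} (inj₁ μ≗0) ν≗ =
  inj₁ (n , λ k → trans (ν≗ k) (jumpTo-vanishingFrom (λ k _ → μ≗0 k) k))
jumpTo-trivial {n} (inj₂ (m , μ≗β)) ν≗ with m <? n
... | yes m<n = inj₁ (n , λ k → trans (ν≗ k) (jumpTo-vanishingFrom vanish k))
  where
  vanish : ∀ k → n ≤ k → _
  vanish k n≤k = trans (μ≗β k) (β-> (<-≤-trans m<n n≤k))
... | no m≮n = inj₂ (n , m , λ k → trans (ν≗ k) (trans (jumpTo-vanishingBelow vanish k) (cong (β n k +_) (μ≗β k))))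
  where
  vanish : ∀ k → k < n → _
  vanish k k<n = trans (μ≗β k) (β-< (<-≤-trans k<n (≮⇒≥ m≮n)))

<a-respˡ-≗ : ∀ {μ μ' ν} → μ ≗ μ' → μ <a ν → μ' <a ν
<a-respˡ-≗ {ν = ν} μ≗μ' (n , lt , above) =
  n , subst (_< ν n) (μ≗μ' n) lt , λ k n<k → trans (sym (μ≗μ' k)) (above k n<k)

<a-respʳ-≗ : ∀ {μ ν ν'} → ν ≗ ν' → μ <a ν → μ <a ν'
<a-respʳ-≗ {μ} ν≗ν' (n , lt , above) =
  n , subst (μ n <_) (ν≗ν' n) lt , λ k n<k → trans (above k n<k) (ν≗ν' k)

<a-irrefl : ∀ {μ} → ¬ μ <a μ
<a-irrefl (_ , lt , _) = <-irrefl refl lt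

<a-trans : ∀ {μ ν ρ} → μ <a ν → ν <a ρ → μ <a ρ
<a-trans {μ} {ν} {ρ} (m , μ<ν , above₁) (n , ν<ρ , above₂) with <-cmp m n
... | tri< m<n _ _ = n , ≤-<-trans (≤-reflexive (above₁ n m<n)) ν<ρ , λ k n<k → trans (above₁ k (<-trans m<n n<k)) (above₂ k n<k)
... | tri≈ _ refl _ = m , <-trans μ<ν ν<ρ , λ k m<k → trans (above₁ k m<k) (above₂ k m<k)
... | tri> _ _ n<m = m , <-≤-trans μ<ν (≤-reflexive (above₂ m n<m)) , λ k m<k → trans (above₁ k m<k) (above₂ k (<-trans n<m m<k))

≤a-refl : ∀ {μ} → μ ≤a μ
≤a-refl = inj₂ λ _ → refl

<a-≤a-trans : ∀ {μ ν ρ} → μ <a ν → ν ≤a ρ → μ <a ρ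
<a-≤a-trans μ<ν (inj₁ ν<ρ) = <a-trans μ<ν ν<ρ
<a-≤a-trans μ<ν (inj₂ ν≗ρ) = <a-respʳ-≗ ν≗ρ μ<ν

≤a-<a-trans : ∀ {μ ν ρ} → μ ≤a ν → ν <a ρ → μ <a ρ
≤a-<a-trans (inj₁ μ<ν) ν<ρ = <a-trans μ<ν ν<ρ
≤a-<a-trans (inj₂ μ≗ν) ν<ρ = <a-respˡ-≗ (sym ∘ μ≗ν) ν<ρ

≤a-trans : ∀ {μ ν ρ} → μ ≤a ν → ν ≤a ρ → μ ≤a ρ
≤a-trans (inj₁ μ<ν) ν≤ρ         = inj₁ (<a-≤a-trans μ<ν ν≤ρ)
≤a-trans (inj₂ μ≗ν) (inj₁ ν<ρ) = inj₁ (<a-respˡ-≗ (sym ∘ μ≗ν) ν<ρ)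
≤a-trans (inj₂ μ≗ν) (inj₂ ν≗ρ) = inj₂ λ k → trans (μ≗ν k) (ν≗ρ k)

Trichotomous : Coeff → Coeff → Set
Trichotomous μ ν = μ <a ν ⊎ μ ≗ ν ⊎ ν <a μ

trichotomous-agreeingFrom : ∀ N {μ ν} → (∀ k → N ≤ k → μ k ≡ ν k) → Trichotomous μ ν
trichotomous-agreeingFrom zero    agree = inj₂ (inj₁ λ k → agree k z≤n)
trichotomous-agreeingFrom (suc N) {μ} {ν} agree with <-cmp (μ N) (ν N)
... | tri< lt _ _ = inj₁ (N , lt , agree)
... | tri> _ _ gt = inj₂ (inj₂ (N , gt , λ k N<k → sym (agree k N<k)))
... | tri≈ _ eq _ = trichotomous-agreeingFrom N agree′
  where
  agree′ : ∀ k → N ≤ k → μ k ≡ ν k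
  agree′ k N≤k with m≤n⇒m<n∨m≡n N≤k
  ... | inj₁ N<k  = agree k N<k
  ... | inj₂ refl = eq

<a-trichotomous : ∀ {μ ν} → FinSupp μ → FinSupp ν → Trichotomous μ ν
<a-trichotomous (M , μ-bound) (N , ν-bound) = trichotomous-agreeingFrom (M + N) λ k M+N≤k →
  trans (μ-bound k (≤-trans (m≤m+n M N) M+N≤k)) (sym (ν-bound k (≤-trans (m≤n+m N M) M+N≤k)))

≤a-total : ∀ {μ ν} → FinSupp μ → FinSupp ν → μ ≤a ν ⊎ ν ≤a μ
≤a-total μ-fin ν-fin with <a-trichotomous μ-fin ν-fin
... | inj₁ μ<ν         = inj₁ (inj₁ μ<ν)
... | inj₂ (inj₁ μ≗ν) = inj₁ (inj₂ μ≗ν)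
... | inj₂ (inj₂ ν<μ) = inj₂ (inj₁ ν<μ)

zeroC<a : ∀ {ν} → FinSupp ν → ¬ ν ≗ zeroC → zeroC <a ν
zeroC<a ν-fin ν≢0 with <a-trichotomous (0 , λ _ _ → refl) ν-fin
... | inj₁ 0<ν                = 0<ν
... | inj₂ (inj₁ 0≗ν)         = contradiction (sym ∘ 0≗ν) ν≢0
... | inj₂ (inj₂ (_ , () , _))

module _ {A : Set} (P : A → Set) (_≼_ : A → A → Set)
         (≼-refl : ∀ {x} → x ≼ x) (≼-trans : ∀ {x y z} → x ≼ y → y ≼ z → x ≼ z)
         (≼-total : ∀ {x y} → P x → P y → x ≼ y ⊎ y ≼ x) where

  -- P need not be decidable, so the maximum is only found under double negation.
  ¬¬-maximum : ∀ {c} → P c → (L : List A) → ¬ ¬ (∃ λ m → P m × All (λ ℓ → P ℓ → ℓ ≼ m) L)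
  ¬¬-maximum Pc []      = pure (_ , Pc , [])
  ¬¬-maximum Pc (ℓ ∷ L) = do
    (m , Pm , below) ← ¬¬-maximum Pc L
    P?ℓ ← ¬¬-excluded-middle
    pure (insert Pm below P?ℓ)
    where
    insert : ∀ {m} → P m → All (λ ℓ → P ℓ → ℓ ≼ m) L → Dec (P ℓ) →
             ∃ λ m′ → P m′ × All (λ ℓ → P ℓ → ℓ ≼ m′) (ℓ ∷ L)
    insert Pm below (no ¬Pℓ) = _ , Pm , (λ Pℓ → contradiction Pℓ ¬Pℓ) ∷ below
    insert Pm below (yes Pℓ) with ≼-total Pm Pℓ
    ... | inj₁ m≼ℓ = _ , Pℓ , (λ _ → ≼-refl) ∷ All.map (λ ≼m Px → ≼-trans (≼m Px) m≼ℓ) below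
    ... | inj₂ ℓ≼m = _ , Pm , (λ _ → ℓ≼m) ∷ below

ImmediateSuccessor : (Coeff → Set) → Coeff → Coeff → Set
ImmediateSuccessor E μ ν = μ <a ν × (∀ ν' → E ν' → μ <a ν' → ν ≤a ν')

module _ {E : Coeff → Set} (Z : Zeckendorf E) where
  open Zeckendorf Z

  ¬¬-predecessor : ∀ {ν} → E ν → ¬ ν ≗ zeroC → ¬ ¬ (∃ λ μ → E μ × ImmediateSuccessor E μ ν)
  ¬¬-predecessor {ν} Eν ν≢0 with finBelow ν Eν
  ... | (L , covers) = do
    (μ , (Eμ , μ<ν) , below) ←
      ¬¬-maximum Below _≤a_ ≤a-refl ≤a-trans (λ (Ex , _) (Ey , _) → ≤a-total (finSupp _ Ex) (finSupp _ Ey))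
                 (hasZero , zeroC<a (finSupp ν Eν) ν≢0) L
    pure (μ , Eμ , μ<ν , successor Eμ μ<ν below)
    where
    Below : Coeff → Set
    Below μ = E μ × μ <a ν
    successor : ∀ {μ} → E μ → μ <a ν → All (λ ℓ → Below ℓ → ℓ ≤a μ) L →
                ∀ ν' → E ν' → μ <a ν' → ν ≤a ν'
    successor {μ} Eμ μ<ν below ν' Eν' μ<ν'
      with <a-trichotomous (finSupp ν' Eν') (finSupp ν Eν)
    ... | inj₂ (inj₁ ν'≗ν) = inj₂ (sym ∘ ν'≗ν)
    ... | inj₂ (inj₂ ν<ν') = inj₁ ν<ν'
    ... | inj₁ ν'<ν with covers ν' Eν' ν'<ν
    ...   | (ℓ , ℓ∈L , ν'≗ℓ) = contradiction (<a-≤a-trans μ<ν' ν'≤μ) <a-irrefl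
      where
      ℓ≤μ : ℓ ≤a μ
      ℓ≤μ = All.lookup below ℓ∈L (ext ν' ℓ ν'≗ℓ Eν' , <a-respˡ-≗ ν'≗ℓ ν'<ν)
      ν'≤μ : ν' ≤a μ
      ν'≤μ = ≤a-trans (inj₂ ν'≗ℓ) ℓ≤μ

  ¬¬-minimalNontrivial : ∀ {ν} → E ν → ¬ IsTrivial ν →
    ¬ ¬ (∃ λ μ → E μ × ¬ IsTrivial μ × ∀ ν' → E ν' → ν' <a μ → ¬ ¬ IsTrivial ν')
  ¬¬-minimalNontrivial {ν} Eν ν-nontrivial with finBelow ν Eν
  ... | (L , covers) = do
    (μ , (Eμ , μ-nontrivial , μ≤ν) , above) ←
      ¬¬-maximum NontrivialBelow (flip _≤a_) ≤a-refl (flip ≤a-trans)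
                 (λ (Ex , _) (Ey , _) → ≤a-total (finSupp _ Ey) (finSupp _ Ex))
                 (Eν , ν-nontrivial , ≤a-refl) L
    pure (μ , Eμ , μ-nontrivial , minimal μ≤ν above)
    where
    NontrivialBelow : Coeff → Set
    NontrivialBelow μ = E μ × ¬ IsTrivial μ × μ ≤a ν
    minimal : ∀ {μ} → μ ≤a ν → All (λ ℓ → NontrivialBelow ℓ → μ ≤a ℓ) L →
              ∀ ν' → E ν' → ν' <a μ → ¬ ¬ IsTrivial ν'
    minimal {μ} μ≤ν above ν' Eν' ν'<μ ν'-nontrivial
      with covers ν' Eν' (<a-≤a-trans ν'<μ μ≤ν)
    ... | (ℓ , ℓ∈L , ν'≗ℓ) = <a-irrefl (≤a-<a-trans (≤a-trans μ≤ℓ (inj₂ (sym ∘ ν'≗ℓ))) ν'<μ)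
      where
      ℓ-nontrivial : ¬ IsTrivial ℓ
      ℓ-nontrivial = ν'-nontrivial ∘ IsTrivial-resp ν'≗ℓ
      μ≤ℓ : μ ≤a ℓ
      μ≤ℓ = All.lookup above ℓ∈L
        (ext ν' ℓ ν'≗ℓ Eν' , ℓ-nontrivial , inj₁ (<a-≤a-trans (<a-respˡ-≗ ν'≗ℓ ν'<μ) μ≤ν))

  ¬¬-successor-of-trivial : ∀ {μ ν} → E μ → E ν → ImmediateSuccessor E μ ν → IsTrivial μ →
    ¬ ¬ (Monomial ν ⊎ Binomial ν)
  ¬¬-successor-of-trivial {μ} {ν} Eμ Eν (μ<ν , least) μ-trivial = do
    ν≟β0⊕μ ← ¬¬-excluded-middle
    pure (shape ν≟β0⊕μ)
    where
    shape : Dec (ν ≗ β 0 ⊕ μ) → Monomial ν ⊎ Binomial ν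
    shape (yes ν≗) = β0⊕-trivial μ-trivial ν≗
    shape (no ν≇) with succShape μ ν Eμ Eν μ<ν least ν≇
    ... | (_ , _ , _ , _ , _ , ν≗) = jumpTo-trivial μ-trivial ν≗

  binomialFree⇒¬nontrivial : (∀ ν → E ν → ¬ Binomial ν) → ¬ Nontrivial E
  binomialFree⇒¬nontrivial binomialFree (ν , Eν , ν≢0 , ν≢β) = (do
    (μ , Eμ , μ-nontrivial , minimal) ← ¬¬-minimalNontrivial Eν [ ν≢0 , (λ (n , ν≗β) → ν≢β n ν≗β) ]
    (π , Eπ , π<μ , least) ← ¬¬-predecessor Eμ (μ-nontrivial ∘ inj₁)
    π-trivial ← minimal π Eπ π<μ
    μ-shape ← ¬¬-successor-of-trivial Eπ Eμ (π<μ , least) π-trivial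
    pure ([ μ-nontrivial ∘ inj₂ , binomialFree μ Eμ ] μ-shape)) id

sumTo-cong : ∀ N {δ δ'} Q → δ ≗ δ' → sumTo N δ Q ≡ sumTo N δ' Q
sumTo-cong zero    Q δ≗δ' = refl
sumTo-cong (suc N) Q δ≗δ' = cong₂ _+_ (sumTo-cong N Q δ≗δ') (cong (_* Q N) (δ≗δ' N))

sumTo-⊕ : ∀ N δ δ' Q → sumTo N (δ ⊕ δ') Q ≡ sumTo N δ Q + sumTo N δ' Q
sumTo-⊕ zero    δ δ' Q = refl
sumTo-⊕ (suc N) δ δ' Q = begin
  sumTo N (δ ⊕ δ') Q + (δ N + δ' N) * Q N
    ≡⟨ cong₂ _+_ (sumTo-⊕ N δ δ' Q) (*-distribʳ-+ (Q N) (δ N) (δ' N)) ⟩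
  (sumTo N δ Q + sumTo N δ' Q) + (δ N * Q N + δ' N * Q N)
    ≡⟨ +-assoc-comm (sumTo N δ Q) (sumTo N δ' Q) (δ N * Q N) (δ' N * Q N) ⟩
  (sumTo N δ Q + δ N * Q N) + (sumTo N δ' Q + δ' N * Q N) ∎
  where
  open ≡-Reasoning
  +-assoc-comm : ∀ w x y z → (w + x) + (y + z) ≡ (w + y) + (x + z)
  +-assoc-comm = solve-∀

sumTo-β-beyond : ∀ N {p} Q → N ≤ p → sumTo N (β p) Q ≡ 0
sumTo-β-beyond zero    Q _   = refl
sumTo-β-beyond (suc N) Q N<p rewrite sumTo-β-beyond N Q (<⇒≤ N<p) | β-< N<p = refl

sumTo-β : ∀ N {p} Q → p < N → sumTo N (β p) Q ≡ Q p
sumTo-β (suc N) {p} Q p<1+N with m≤n⇒m<n∨m≡n (≤-pred p<1+N)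
... | inj₁ p<N  rewrite sumTo-β N Q p<N | β-> p<N = +-identityʳ (Q p)
... | inj₂ refl rewrite sumTo-β-beyond N Q ≤-refl | β-diag N = +-identityʳ (Q N)

SumIs-cong : ∀ {δ δ' Q s} → δ ≗ δ' → SumIs δ' Q s → SumIs δ Q s
SumIs-cong {Q = Q} δ≗δ' (N , bound , sum) =
  N , (λ k N≤k → trans (δ≗δ' k) (bound k N≤k)) , trans (sumTo-cong N Q δ≗δ') sum

SumIs-β : ∀ p Q → SumIs (β p) Q (Q p)
SumIs-β p Q = suc p , (λ _ → β->) , sumTo-β (suc p) Q ≤-refl

SumIs-binomial : ∀ p q Q → SumIs (β p ⊕ β q) Q (Q p + Q q)
SumIs-binomial p q Q = N , bound , trans (sumTo-⊕ N (β p) (β q) Q) (cong₂ _+_ (sumTo-β N Q p<N) (sumTo-β N Q q<N))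
  where
  N = suc (p + q)
  p<N : p < N
  p<N = s≤s (m≤m+n p q)
  q<N : q < N
  q<N = s≤s (m≤n+m q p)
  bound : Bound (β p ⊕ β q) N
  bound k N≤k = cong₂ _+_ (β-> (<-≤-trans p<N N≤k)) (β-> (<-≤-trans q<N N≤k))

binomial≢zeroC : ∀ p q → ¬ (β p ⊕ β q) ≗ zeroC
binomial≢zeroC p q ≗0 = contradiction (≗0 p) (λ eq → 1+n≢0 (trans (cong (_+ β q p) (sym (β-diag p))) eq))

arithProg-¬sum : ∀ {j a x y} → 0 < j → j < a →
  ArithProg j a x → ArithProg j a y → ¬ ArithProg j a (x + y)
arithProg-¬sum {j} {a} 0<j j<a (m , _ , refl) (n , _ , refl) (k , _ , sum≡) = <-irrefl (sym j≡0) 0<j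
  where
  open ≡-Reasoning
  instance
    a≢0 : NonZero a
    a≢0 = >-nonZero (<-trans 0<j j<a)
  regroup : ∀ j a m n → j + (j + (m + n) * a) ≡ (j + a * m) + (j + a * n)
  regroup = solve-∀
  j+[m+n]a≡ka : j + (m + n) * a ≡ k * a
  j+[m+n]a≡ka = +-cancelˡ-≡ j _ _ (begin
    j + (j + (m + n) * a)     ≡⟨ regroup j a m n ⟩
    (j + a * m) + (j + a * n) ≡⟨ sum≡ ⟩
    j + a * k                 ≡⟨ cong (j +_) (*-comm a k) ⟩
    j + k * a                 ∎)
  j≡0 : j ≡ 0
  j≡0 = begin
    j                     ≡⟨ m<n⇒m%n≡m j<a ⟨
    j % a                 ≡⟨ [m+kn]%n≡m%n j (m + n) a ⟨
    (j + (m + n) * a) % a ≡⟨ cong (_% a) j+[m+n]a≡ka ⟩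
    k * a % a             ≡⟨ m*n%n≡0 k a ⟩
    0                     ∎

progressionSubset⇒binomialFree : ∀ {E j a} → Zeckendorf E → 0 < j → j < a →
  IsESubset E (ArithProg j a) → ∀ ν → E ν → ¬ Binomial ν
progressionSubset⇒binomialFree {E} {j} {a} Z 0<j j<a (Q , _ , _ , Y⇔) ν Eν (p , q , ν≗) =
  arithProg-¬sum 0<j j<a (value (hasβ p) (β≢zeroC p) (SumIs-β p Q))
                         (value (hasβ q) (β≢zeroC q) (SumIs-β q Q))
                         (value Eν (binomial≢zeroC p q ∘ λ ≗0 k → trans (sym (ν≗ k)) (≗0 k))
                                (SumIs-cong ν≗ (SumIs-binomial p q Q)))
  where
  open Zeckendorf Z
  value : ∀ {δ y} → E δ → ¬ δ ≗ zeroC → SumIs δ Q y → ArithProg j a y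
  value Eδ δ≢0 sum = Equivalence.from (Y⇔ _) (_ , Eδ , δ≢0 , sum)

proposition4p1 : (a j : ℕ) → 1 < a → 0 < j → j < a → gcd j a ≡ 1 →
    (E : Coeff → Set) → Zeckendorf E → Nontrivial E →
    ¬ IsESubset E (ArithProg j a)
proposition4p1 a j _ 0<j j<a _ E Z nontrivial progression =
  binomialFree⇒¬nontrivial Z (progressionSubset⇒binomialFree Z 0<j j<a progression) nontrivial
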